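{- For every positive integer $m$ there exists a palindromic graph on $8m$ vertices having no vertex of degree $1$.
   Context: All graphs are finite, simple and undirected. For a graph $G$ on $n$ vertices with adjacency matrix $A_G$, its characteristic polynomial is $\chi_G(\lambda)=\det(\lambda I-A_G)=a_0\lambda^n+a_1\lambda^{n-1}+\dots+a_n$. $G$ is palindromic if $a_i=a_{n-i}$ for all $i=0,\dots,n$. A graph with no vertex of degree $1$ is called bald. -}

module Defs where

open import Data.Nat as ℕ using (ℕ; zero; suc; _∸_)
open import Data.Integer as ℤ using (ℤ; 0ℤ; 1ℤ; -_)
open import Data.Fin using (Fin; zero; suc; toℕ; punchIn; _≟_)
open import Data.Bool using (Bool; true; false; if_then_else_)
open import Data.List using (List; []; _∷_; map; foldr)
open import Data.Nat.ListAction using (sum)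
open import Data.List.Base using (allFin)
open import Relation.Nullary using (yes; no; ¬_)
open import Relation.Nullary.Decidable using (⌊_⌋)
open import Relation.Binary.PropositionalEquality using (_≡_)

record Graph (n : ℕ) : Set where
  field
    adj     : Fin n → Fin n → Bool
    symm    : ∀ i j → adj i j ≡ adj j i
    irrefl  : ∀ i → adj i i ≡ false

open Graph public

degree : ∀ {n} → Graph n → Fin n → ℕ
degree {n} G i = sum (map (λ j → if adj G i j then 1 else 0) (allFin n))

Bald : ∀ {n} → Graph n → Set
Bald {n} G = ∀ (i : Fin n) → ¬ (degree G i ≡ 1)

-- Polynomials over ℤ as lists of coefficients, lowest degree first
-- (not normalised; only compared via `coeff`)

Poly : Set
Poly = List ℤ

_+P_ : Poly → Poly → Poly
[]       +P q        = q
(a ∷ p)  +P []       = a ∷ p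
(a ∷ p)  +P (b ∷ q)  = (a ℤ.+ b) ∷ (p +P q)

_*P_ : Poly → Poly → Poly
[]      *P q = []
(a ∷ p) *P q = map (a ℤ.*_) q +P (0ℤ ∷ (p *P q))

coeff : Poly → ℕ → ℤ
coeff []      _       = 0ℤ
coeff (a ∷ p) zero    = a
coeff (a ∷ p) (suc k) = coeff p k

sumP : List Poly → Poly
sumP = foldr _+P_ []

sign : ℕ → ℤ
sign zero    = 1ℤ
sign (suc k) = - sign k

det : ∀ n → (Fin n → Fin n → Poly) → Poly
det zero    M = 1ℤ ∷ []
det (suc n) M =
  sumP (map (λ j → ((sign (toℕ j) ∷ []) *P M zero j)
                     *P det n (λ r c → M (suc r) (punchIn j c)))
            (allFin (suc n)))

adjMatrix : ∀ {n} → Graph n → Fin n → Fin n → ℤ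
adjMatrix G i j = if adj G i j then 1ℤ else 0ℤ

charMatrix : ∀ {n} → Graph n → Fin n → Fin n → Poly
charMatrix G i j =
  ((if ⌊ i ≟ j ⌋ then 0ℤ ∷ 1ℤ ∷ [] else []) +P (- adjMatrix G i j ∷ []))

charPoly : ∀ {n} → Graph n → Poly
charPoly {n} G = det n (charMatrix G)

charCoeff : ∀ {n} → Graph n → ℕ → ℤ
charCoeff {n} G i = coeff (charPoly G) (n ∸ i)

Palindromic : ∀ {n} → Graph n → Set
Palindromic {n} G = ∀ (i : Fin (suc n)) → charCoeff G (toℕ i) ≡ charCoeff G (n ∸ toℕ i)

{-# OPTIONS --safe #-}
-- The characteristic polynomial of a disjoint union G ⊕ H is the product of those of G and H,
-- since λI − A is block diagonal; and a product of self-reciprocal polynomials of degrees k and n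
-- is self-reciprocal of degree k + n. Every vertex of G ⊕ H keeps its degree, so baldness is
-- inherited as well. Hence m disjoint copies of one bald palindromic graph on 8 vertices do the job,
-- and one such graph is bipartite with parts of size 4 and characteristic polynomial
-- λ⁸ − 10λ⁶ + 23λ⁴ − 10λ² + 1, which is checked by evaluating the determinant.
module Submission where

open import Defs
open import Data.Nat as ℕ using (ℕ; zero; suc; _+_; _*_; _∸_; _≤_; _<_; z≤n; s≤s)
open import Data.Nat.Properties using (m≤n+m; +-identityʳ; *-comm; m∸n≤m)
open import Data.Nat.ListAction using (sum)
open import Data.Nat.ListAction.Properties using (sum-++)
open import Data.Integer as ℤ using (ℤ; +_; -[1+_]; -_; 0ℤ; 1ℤ)
import Data.Integer.Properties as ℤP
open import Algebra.Properties.CommutativeSemigroup ℤP.+-commutativeSemigroup using (interchange)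
open import Data.Fin using (Fin; zero; suc; toℕ; punchIn; _↑ˡ_; _↑ʳ_; splitAt; _≟_)
open import Data.Fin.Properties
  using (toℕ-↑ˡ; splitAt-↑ˡ; splitAt-↑ʳ; splitAt⁻¹-↑ˡ; splitAt⁻¹-↑ʳ; ↑ˡ-injective; ↑ʳ-injective; all?)
open import Data.List using ([]; _∷_; map; tabulate; _++_; allFin)
open import Data.List.Properties using (map-tabulate; map-cong)
open import Data.Vec using (Vec; []; _∷_; lookup)
open import Data.Bool using (Bool; true; false; if_then_else_)
open import Data.Sum using (_⊎_; inj₁; inj₂)
open import Data.Product using (Σ; _×_; _,_)
open import Data.Empty using (⊥-elim)
open import Function using (_∘_; id)
open import Relation.Nullary using (yes; no)
open import Relation.Nullary.Decidable using (⌊_⌋; toWitness; ¬?)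
open import Relation.Binary.Bundles using (Setoid)
open import Relation.Binary.PropositionalEquality
import Relation.Binary.Reasoning.Setoid as SetoidReasoning

-- Polynomials up to equality of coefficients

infix 4 _≈_
record _≈_ (p q : Poly) : Set where
  constructor mk≈
  field coeff-≡ : ∀ k → coeff p k ≡ coeff q k
open _≈_ public

≈-refl : ∀ {p} → p ≈ p
≈-refl = mk≈ λ _ → refl

≈-reflexive : ∀ {p q} → p ≡ q → p ≈ q
≈-reflexive refl = ≈-refl

≈-sym : ∀ {p q} → p ≈ q → q ≈ p
≈-sym p≈q = mk≈ λ k → sym (coeff-≡ p≈q k)

≈-trans : ∀ {p q r} → p ≈ q → q ≈ r → p ≈ r
≈-trans p≈q q≈r = mk≈ λ k → trans (coeff-≡ p≈q k) (coeff-≡ q≈r k)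

≈-setoid : Setoid _ _
≈-setoid = record
  { Carrier = Poly ; _≈_ = _≈_
  ; isEquivalence = record { refl = ≈-refl ; sym = ≈-sym ; trans = ≈-trans } }

module ≈-Reasoning = SetoidReasoning ≈-setoid

∷-cong : ∀ {a b p q} → a ≡ b → p ≈ q → a ∷ p ≈ b ∷ q
∷-cong a≡b p≈q = mk≈ λ { zero → a≡b ; (suc k) → coeff-≡ p≈q k }

∷-≈[] : ∀ {a p} → a ≡ 0ℤ → p ≈ [] → a ∷ p ≈ []
∷-≈[] a≡0 p≈[] = mk≈ λ { zero → a≡0 ; (suc k) → coeff-≡ p≈[] k }

scale : ℤ → Poly → Poly
scale a = map (a ℤ.*_)

coeff-+P : ∀ p q k → coeff (p +P q) k ≡ coeff p k ℤ.+ coeff q k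
coeff-+P []      q       k       = sym (ℤP.+-identityˡ (coeff q k))
coeff-+P (a ∷ p) []      k       = sym (ℤP.+-identityʳ (coeff (a ∷ p) k))
coeff-+P (a ∷ p) (b ∷ q) zero    = refl
coeff-+P (a ∷ p) (b ∷ q) (suc k) = coeff-+P p q k

coeff-scale : ∀ a q k → coeff (scale a q) k ≡ a ℤ.* coeff q k
coeff-scale a []      k       = sym (ℤP.*-zeroʳ a)
coeff-scale a (b ∷ q) zero    = refl
coeff-scale a (b ∷ q) (suc k) = coeff-scale a q k

+P-cong : ∀ {p p′ q q′} → p ≈ p′ → q ≈ q′ → p +P q ≈ p′ +P q′
+P-cong {p} {p′} {q} {q′} p≈p′ q≈q′ = mk≈ λ k → begin
  coeff (p +P q) k            ≡⟨ coeff-+P p q k ⟩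
  coeff p k ℤ.+ coeff q k     ≡⟨ cong₂ ℤ._+_ (coeff-≡ p≈p′ k) (coeff-≡ q≈q′ k) ⟩
  coeff p′ k ℤ.+ coeff q′ k   ≡⟨ coeff-+P p′ q′ k ⟨
  coeff (p′ +P q′) k          ∎
  where open ≡-Reasoning

+P-comm : ∀ p q → p +P q ≈ q +P p
+P-comm p q = mk≈ λ k → begin
  coeff (p +P q) k          ≡⟨ coeff-+P p q k ⟩
  coeff p k ℤ.+ coeff q k   ≡⟨ ℤP.+-comm (coeff p k) (coeff q k) ⟩
  coeff q k ℤ.+ coeff p k   ≡⟨ coeff-+P q p k ⟨
  coeff (q +P p) k          ∎
  where open ≡-Reasoning

+P-assoc : ∀ p q r → (p +P q) +P r ≈ p +P (q +P r)
+P-assoc p q r = mk≈ λ k → begin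
  coeff ((p +P q) +P r) k                     ≡⟨ coeff-+P (p +P q) r k ⟩
  coeff (p +P q) k ℤ.+ coeff r k              ≡⟨ cong (ℤ._+ coeff r k) (coeff-+P p q k) ⟩
  (coeff p k ℤ.+ coeff q k) ℤ.+ coeff r k     ≡⟨ ℤP.+-assoc (coeff p k) (coeff q k) (coeff r k) ⟩
  coeff p k ℤ.+ (coeff q k ℤ.+ coeff r k)     ≡⟨ cong (λ x → coeff p k ℤ.+ x) (coeff-+P q r k) ⟨
  coeff p k ℤ.+ coeff (q +P r) k              ≡⟨ coeff-+P p (q +P r) k ⟨
  coeff (p +P (q +P r)) k                     ∎
  where open ≡-Reasoning

+P-identityʳ : ∀ p → p +P [] ≈ p
+P-identityʳ p = mk≈ λ k → trans (coeff-+P p [] k) (ℤP.+-identityʳ (coeff p k))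

+P-interchange : ∀ p q r s → (p +P q) +P (r +P s) ≈ (p +P r) +P (q +P s)
+P-interchange p q r s = mk≈ λ k → begin
  coeff ((p +P q) +P (r +P s)) k
    ≡⟨ trans (coeff-+P (p +P q) (r +P s) k) (cong₂ ℤ._+_ (coeff-+P p q k) (coeff-+P r s k)) ⟩
  (coeff p k ℤ.+ coeff q k) ℤ.+ (coeff r k ℤ.+ coeff s k)
    ≡⟨ interchange (coeff p k) (coeff q k) (coeff r k) (coeff s k) ⟩
  (coeff p k ℤ.+ coeff r k) ℤ.+ (coeff q k ℤ.+ coeff s k)
    ≡⟨ trans (coeff-+P (p +P r) (q +P s) k) (cong₂ ℤ._+_ (coeff-+P p r k) (coeff-+P q s k)) ⟨
  coeff ((p +P r) +P (q +P s)) k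
    ∎
  where open ≡-Reasoning

scale-cong : ∀ a {q q′} → q ≈ q′ → scale a q ≈ scale a q′
scale-cong a {q} {q′} q≈q′ = mk≈ λ k →
  trans (coeff-scale a q k) (trans (cong (a ℤ.*_) (coeff-≡ q≈q′ k)) (sym (coeff-scale a q′ k)))

scale-+P : ∀ a p q → scale a (p +P q) ≈ scale a p +P scale a q
scale-+P a p q = mk≈ λ k → begin
  coeff (scale a (p +P q)) k                    ≡⟨ coeff-scale a (p +P q) k ⟩
  a ℤ.* coeff (p +P q) k                        ≡⟨ cong (a ℤ.*_) (coeff-+P p q k) ⟩
  a ℤ.* (coeff p k ℤ.+ coeff q k)               ≡⟨ ℤP.*-distribˡ-+ a (coeff p k) (coeff q k) ⟩
  a ℤ.* coeff p k ℤ.+ a ℤ.* coeff q k           ≡⟨ cong₂ ℤ._+_ (coeff-scale a p k) (coeff-scale a q k) ⟨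
  coeff (scale a p) k ℤ.+ coeff (scale a q) k   ≡⟨ coeff-+P (scale a p) (scale a q) k ⟨
  coeff (scale a p +P scale a q) k              ∎
  where open ≡-Reasoning

scale-distribʳ : ∀ a b q → scale (a ℤ.+ b) q ≈ scale a q +P scale b q
scale-distribʳ a b q = mk≈ λ k → begin
  coeff (scale (a ℤ.+ b) q) k                   ≡⟨ coeff-scale (a ℤ.+ b) q k ⟩
  (a ℤ.+ b) ℤ.* coeff q k                       ≡⟨ ℤP.*-distribʳ-+ (coeff q k) a b ⟩
  a ℤ.* coeff q k ℤ.+ b ℤ.* coeff q k           ≡⟨ cong₂ ℤ._+_ (coeff-scale a q k) (coeff-scale b q k) ⟨
  coeff (scale a q) k ℤ.+ coeff (scale b q) k   ≡⟨ coeff-+P (scale a q) (scale b q) k ⟨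
  coeff (scale a q +P scale b q) k              ∎
  where open ≡-Reasoning

scale-zero : ∀ {a} q → a ≡ 0ℤ → scale a q ≈ []
scale-zero {a} q refl = mk≈ λ k → coeff-scale 0ℤ q k

scale-identity : ∀ q → scale 1ℤ q ≈ q
scale-identity q = mk≈ λ k → trans (coeff-scale 1ℤ q k) (ℤP.*-identityˡ (coeff q k))

*P-zeroˡ : ∀ {p} q → p ≈ [] → p *P q ≈ []
*P-zeroˡ {[]}    q p≈[] = ≈-refl
*P-zeroˡ {a ∷ p} q p≈[] =
  +P-cong (scale-zero q (coeff-≡ p≈[] 0)) (∷-≈[] refl (*P-zeroˡ {p} q (mk≈ λ k → coeff-≡ p≈[] (suc k))))

*P-zeroʳ : ∀ p → p *P [] ≈ []
*P-zeroʳ []      = ≈-refl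
*P-zeroʳ (a ∷ p) = ∷-≈[] refl (*P-zeroʳ p)

*P-congˡ : ∀ {p p′} q → p ≈ p′ → p *P q ≈ p′ *P q
*P-congˡ {[]}    {p′}     q p≈p′ = ≈-sym (*P-zeroˡ q (≈-sym p≈p′))
*P-congˡ {a ∷ p} {[]}     q p≈p′ = *P-zeroˡ q p≈p′
*P-congˡ {a ∷ p} {b ∷ p′} q p≈p′ =
  +P-cong (≈-reflexive (cong (λ c → scale c q) (coeff-≡ p≈p′ 0)))
          (∷-cong refl (*P-congˡ {p} {p′} q (mk≈ λ k → coeff-≡ p≈p′ (suc k))))

*P-congʳ : ∀ p {q q′} → q ≈ q′ → p *P q ≈ p *P q′
*P-congʳ []      q≈q′ = ≈-refl
*P-congʳ (a ∷ p) q≈q′ = +P-cong (scale-cong a q≈q′) (∷-cong refl (*P-congʳ p q≈q′))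

*P-identityˡ : ∀ q → (1ℤ ∷ []) *P q ≈ q
*P-identityˡ q = ≈-trans (+P-cong (scale-identity q) (∷-≈[] refl ≈-refl)) (+P-identityʳ q)

0∷-*P : ∀ p q → (0ℤ ∷ p) *P q ≈ 0ℤ ∷ (p *P q)
0∷-*P p q = +P-cong (scale-zero q refl) ≈-refl

scale-assoc : ∀ a b q → scale (a ℤ.* b) q ≈ scale a (scale b q)
scale-assoc a b q = mk≈ λ k → begin
  coeff (scale (a ℤ.* b) q) k   ≡⟨ coeff-scale (a ℤ.* b) q k ⟩
  a ℤ.* b ℤ.* coeff q k         ≡⟨ ℤP.*-assoc a b (coeff q k) ⟩
  a ℤ.* (b ℤ.* coeff q k)       ≡⟨ cong (a ℤ.*_) (coeff-scale b q k) ⟨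
  a ℤ.* coeff (scale b q) k     ≡⟨ coeff-scale a (scale b q) k ⟨
  coeff (scale a (scale b q)) k ∎
  where open ≡-Reasoning

scale-*P : ∀ a p q → scale a p *P q ≈ scale a (p *P q)
scale-*P a []      q = ≈-refl
scale-*P a (b ∷ p) q = begin
  scale (a ℤ.* b) q +P (0ℤ ∷ (scale a p *P q))
    ≈⟨ +P-cong (scale-assoc a b q) (∷-cong (sym (ℤP.*-zeroʳ a)) (scale-*P a p q)) ⟩
  scale a (scale b q) +P scale a (0ℤ ∷ (p *P q))
    ≈⟨ scale-+P a (scale b q) (0ℤ ∷ (p *P q)) ⟨
  scale a (scale b q +P (0ℤ ∷ (p *P q)))
    ∎
  where open ≈-Reasoning

*P-distribʳ : ∀ p q r → (p +P q) *P r ≈ (p *P r) +P (q *P r)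
*P-distribʳ []      q       r = ≈-refl
*P-distribʳ (a ∷ p) []      r = ≈-sym (+P-identityʳ ((a ∷ p) *P r))
*P-distribʳ (a ∷ p) (b ∷ q) r = begin
  scale (a ℤ.+ b) r +P (0ℤ ∷ ((p +P q) *P r))
    ≈⟨ +P-cong (scale-distribʳ a b r) (∷-cong refl (*P-distribʳ p q r)) ⟩
  (scale a r +P scale b r) +P ((0ℤ ∷ (p *P r)) +P (0ℤ ∷ (q *P r)))
    ≈⟨ +P-interchange (scale a r) (scale b r) (0ℤ ∷ (p *P r)) (0ℤ ∷ (q *P r)) ⟩
  (scale a r +P (0ℤ ∷ (p *P r))) +P (scale b r +P (0ℤ ∷ (q *P r)))
    ∎
  where open ≈-Reasoning

*P-assoc : ∀ p q r → (p *P q) *P r ≈ p *P (q *P r)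
*P-assoc []      q r = ≈-refl
*P-assoc (a ∷ p) q r = begin
  (scale a q +P (0ℤ ∷ (p *P q))) *P r
    ≈⟨ *P-distribʳ (scale a q) (0ℤ ∷ (p *P q)) r ⟩
  (scale a q *P r) +P ((0ℤ ∷ (p *P q)) *P r)
    ≈⟨ +P-cong (scale-*P a q r) (≈-trans (0∷-*P (p *P q) r) (∷-cong refl (*P-assoc p q r))) ⟩
  scale a (q *P r) +P (0ℤ ∷ (p *P (q *P r)))
    ∎
  where open ≈-Reasoning

sumP-cong : ∀ {A : Set} {f g : A → Poly} xs → (∀ x → f x ≈ g x) → sumP (map f xs) ≈ sumP (map g xs)
sumP-cong []       f≈g = ≈-refl
sumP-cong (x ∷ xs) f≈g = +P-cong (f≈g x) (sumP-cong xs f≈g)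

sumP-zero : ∀ {A : Set} {f : A → Poly} xs → (∀ x → f x ≈ []) → sumP (map f xs) ≈ []
sumP-zero []       f≈[] = ≈-refl
sumP-zero (x ∷ xs) f≈[] = +P-cong (f≈[] x) (sumP-zero xs f≈[])

sumP-++ : ∀ xs ys → sumP (xs ++ ys) ≈ sumP xs +P sumP ys
sumP-++ []       ys = ≈-refl
sumP-++ (x ∷ xs) ys = ≈-trans (+P-cong (≈-refl {x}) (sumP-++ xs ys)) (≈-sym (+P-assoc x (sumP xs) (sumP ys)))

sumP-*P-distribʳ : ∀ {A : Set} (f : A → Poly) r xs → sumP (map (λ x → f x *P r) xs) ≈ sumP (map f xs) *P r
sumP-*P-distribʳ f r []       = ≈-refl
sumP-*P-distribʳ f r (x ∷ xs) =
  ≈-trans (+P-cong (≈-refl {f x *P r}) (sumP-*P-distribʳ f r xs)) (≈-sym (*P-distribʳ (f x) _ r))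

-- Determinants

tabulate-+ : ∀ {A : Set} k n (f : Fin (k + n) → A) →
             tabulate f ≡ tabulate (f ∘ (_↑ˡ n)) ++ tabulate (f ∘ (k ↑ʳ_))
tabulate-+ zero    n f = refl
tabulate-+ (suc k) n f = cong (f zero ∷_) (tabulate-+ k n (f ∘ suc))

map-allFin-+ : ∀ {A : Set} k n (f : Fin (k + n) → A) →
               map f (allFin (k + n)) ≡ map (f ∘ (_↑ˡ n)) (allFin k) ++ map (f ∘ (k ↑ʳ_)) (allFin n)
map-allFin-+ k n f = begin
  map f (allFin (k + n))
    ≡⟨ map-tabulate id f ⟩
  tabulate f
    ≡⟨ tabulate-+ k n f ⟩
  tabulate (f ∘ (_↑ˡ n)) ++ tabulate (f ∘ (k ↑ʳ_))
    ≡⟨ cong₂ _++_ (map-tabulate id (f ∘ (_↑ˡ n))) (map-tabulate id (f ∘ (k ↑ʳ_))) ⟨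
  map (f ∘ (_↑ˡ n)) (allFin k) ++ map (f ∘ (k ↑ʳ_)) (allFin n)
    ∎
  where open ≡-Reasoning

Matrix : ℕ → Set
Matrix n = Fin n → Fin n → Poly

minor : ∀ {n} → Matrix (suc n) → Fin (suc n) → Matrix n
minor M j r c = M (suc r) (punchIn j c)

cofactorTerm : ∀ {n} → Matrix (suc n) → Fin (suc n) → Poly
cofactorTerm {n} M j = ((sign (toℕ j) ∷ []) *P M zero j) *P det n (minor M j)

cofactorTerm-zero : ∀ {n} (M : Matrix (suc n)) j → M zero j ≈ [] → cofactorTerm M j ≈ []
cofactorTerm-zero {n} M j Mj≈[] =
  *P-zeroˡ (det n (minor M j))
    (≈-trans (*P-congʳ (sign (toℕ j) ∷ []) Mj≈[]) (*P-zeroʳ (sign (toℕ j) ∷ [])))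

det-cong : ∀ n {M N : Matrix n} → (∀ i j → M i j ≈ N i j) → det n M ≈ det n N
det-cong zero    M≈N = ≈-refl
det-cong (suc n) {M} {N} M≈N = sumP-cong (allFin (suc n)) λ j →
  ≈-trans (*P-congˡ (det n (minor M j)) (*P-congʳ (sign (toℕ j) ∷ []) (M≈N zero j)))
          (*P-congʳ ((sign (toℕ j) ∷ []) *P N zero j) (det-cong n λ r c → M≈N (suc r) (punchIn j c)))

topLeft : ∀ k n → Matrix (k + n) → Matrix k
topLeft k n M i j = M (i ↑ˡ n) (j ↑ˡ n)

bottomRight : ∀ k n → Matrix (k + n) → Matrix n
bottomRight k n M i j = M (k ↑ʳ i) (k ↑ʳ j)

punchIn-↑ˡ : ∀ {k} n (j : Fin (suc k)) (c : Fin k) → punchIn (j ↑ˡ n) (c ↑ˡ n) ≡ punchIn j c ↑ˡ n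
punchIn-↑ˡ n zero    c       = refl
punchIn-↑ˡ n (suc j) zero    = refl
punchIn-↑ˡ n (suc j) (suc c) = cong suc (punchIn-↑ˡ n j c)

punchIn-↑ʳ : ∀ {k} n (j : Fin (suc k)) (c : Fin n) → punchIn (j ↑ˡ n) (k ↑ʳ c) ≡ suc k ↑ʳ c
punchIn-↑ʳ         n zero    c = refl
punchIn-↑ʳ {suc k} n (suc j) c = cong suc (punchIn-↑ʳ n j c)

-- Expanding along the first row, the terms from the right block vanish and every remaining
-- minor is again block lower triangular, with the same bottom-right block.
det-blockLowerTriangular : ∀ k n (M : Matrix (k + n)) → (∀ i j → M (i ↑ˡ n) (k ↑ʳ j) ≈ []) →
  det (k + n) M ≈ det k (topLeft k n M) *P det n (bottomRight k n M)
det-blockLowerTriangular zero    n M _         = ≈-sym (*P-identityˡ (det n M))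
det-blockLowerTriangular (suc k) n M upperZero = begin
  sumP (map (cofactorTerm M) (allFin (suc k + n)))
    ≡⟨ cong sumP (map-allFin-+ (suc k) n (cofactorTerm M)) ⟩
  sumP (map (cofactorTerm M ∘ (_↑ˡ n)) (allFin (suc k)) ++ map (cofactorTerm M ∘ (suc k ↑ʳ_)) (allFin n))
    ≈⟨ sumP-++ (map (cofactorTerm M ∘ (_↑ˡ n)) (allFin (suc k))) _ ⟩
  sumP (map (cofactorTerm M ∘ (_↑ˡ n)) (allFin (suc k))) +P sumP (map (cofactorTerm M ∘ (suc k ↑ʳ_)) (allFin n))
    ≈⟨ +P-cong (sumP-cong (allFin (suc k)) leftTerm)
               (sumP-zero (allFin n) λ j → cofactorTerm-zero M (suc k ↑ʳ j) (upperZero zero j)) ⟩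
  sumP (map (λ j → cofactorTerm TL j *P D) (allFin (suc k))) +P []
    ≈⟨ +P-identityʳ _ ⟩
  sumP (map (λ j → cofactorTerm TL j *P D) (allFin (suc k)))
    ≈⟨ sumP-*P-distribʳ (cofactorTerm TL) D (allFin (suc k)) ⟩
  det (suc k) TL *P D
    ∎
  where
  open ≈-Reasoning
  TL : Matrix (suc k)
  TL = topLeft (suc k) n M
  D : Poly
  D = det n (bottomRight (suc k) n M)

  minorBlocks : ∀ j → det (k + n) (minor M (j ↑ˡ n)) ≈ det k (minor TL j) *P D
  minorBlocks j = begin
    det (k + n) (minor M (j ↑ˡ n))
      ≈⟨ det-blockLowerTriangular k n (minor M (j ↑ˡ n)) (λ i c →
           ≈-trans (≈-reflexive (cong (M (suc (i ↑ˡ n))) (punchIn-↑ʳ n j c))) (upperZero (suc i) c)) ⟩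
    det k (topLeft k n (minor M (j ↑ˡ n))) *P det n (bottomRight k n (minor M (j ↑ˡ n)))
      ≈⟨ *P-congˡ _ (det-cong k λ r c → ≈-reflexive (cong (M (suc (r ↑ˡ n))) (punchIn-↑ˡ n j c))) ⟩
    det k (minor TL j) *P det n (bottomRight k n (minor M (j ↑ˡ n)))
      ≈⟨ *P-congʳ (det k (minor TL j)) (det-cong n λ r c → ≈-reflexive (cong (M (suc (k ↑ʳ r))) (punchIn-↑ʳ n j c))) ⟩
    det k (minor TL j) *P D
      ∎

  leftTerm : ∀ j → cofactorTerm M (j ↑ˡ n) ≈ cofactorTerm TL j *P D
  leftTerm j = begin
    ((sign (toℕ (j ↑ˡ n)) ∷ []) *P M zero (j ↑ˡ n)) *P det (k + n) (minor M (j ↑ˡ n))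
      ≡⟨ cong (λ t → ((sign t ∷ []) *P TL zero j) *P det (k + n) (minor M (j ↑ˡ n))) (toℕ-↑ˡ j n) ⟩
    ((sign (toℕ j) ∷ []) *P TL zero j) *P det (k + n) (minor M (j ↑ˡ n))
      ≈⟨ *P-congʳ ((sign (toℕ j) ∷ []) *P TL zero j) (minorBlocks j) ⟩
    ((sign (toℕ j) ∷ []) *P TL zero j) *P (det k (minor TL j) *P D)
      ≈⟨ *P-assoc ((sign (toℕ j) ∷ []) *P TL zero j) (det k (minor TL j)) D ⟨
    cofactorTerm TL j *P D
      ∎

isZero : Poly → Bool
isZero []          = true
isZero (+ 0 ∷ p)   = isZero p
isZero (_ ∷ _)     = false

isZero-sound : ∀ p → isZero p ≡ true → p ≈ []
isZero-sound []               _ = ≈-refl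
isZero-sound (+ 0 ∷ p)        e = ∷-≈[] refl (isZero-sound p e)
isZero-sound (+ suc _ ∷ _)    ()
isZero-sound (-[1+ _ ] ∷ _)   ()

-- Laplace expansion that skips zero entries of the first row, so that the determinant
-- of a sparse concrete matrix can be evaluated by normalisation.
sparseDet : ∀ n → Matrix n → Poly
sparseDet zero    M = 1ℤ ∷ []
sparseDet (suc n) M = sumP (map term (allFin (suc n)))
  where
  term : Fin (suc n) → Poly
  term j = if isZero (M zero j) then [] else ((sign (toℕ j) ∷ []) *P M zero j) *P sparseDet n (minor M j)

det≈sparseDet : ∀ n M → det n M ≈ sparseDet n M
det≈sparseDet zero    M = ≈-refl
det≈sparseDet (suc n) M = sumP-cong (allFin (suc n)) term≈
  where
  term≈ : ∀ j → cofactorTerm M j ≈ (if isZero (M zero j) then [] else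
                  ((sign (toℕ j) ∷ []) *P M zero j) *P sparseDet n (minor M j))
  term≈ j with isZero (M zero j) in eq
  ... | true  = cofactorTerm-zero M j (isZero-sound (M zero j) eq)
  ... | false = *P-congʳ ((sign (toℕ j) ∷ []) *P M zero j) (det≈sparseDet n (minor M j))

-- Reciprocal polynomials

-- reciprocal d p = λᵈ p(1/λ), provided p has degree at most d
reciprocal : ℕ → Poly → Poly
reciprocal zero    p = coeff p 0 ∷ []
reciprocal (suc d) p = coeff p (suc d) ∷ reciprocal d p

coeff-reciprocal : ∀ d p {i} → i ≤ d → coeff (reciprocal d p) i ≡ coeff p (d ∸ i)
coeff-reciprocal zero    p z≤n     = refl
coeff-reciprocal (suc d) p z≤n     = refl
coeff-reciprocal (suc d) p (s≤s i≤d) = coeff-reciprocal d p i≤d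

coeff-reciprocal-> : ∀ d p {i} → d < i → coeff (reciprocal d p) i ≡ 0ℤ
coeff-reciprocal-> zero    p {suc zero}    (s≤s z≤n) = refl
coeff-reciprocal-> zero    p {suc (suc i)} (s≤s z≤n) = refl
coeff-reciprocal-> (suc d) p {suc i}       (s≤s d<i) = coeff-reciprocal-> d p d<i

DegreeAtMost : ℕ → Poly → Set
DegreeAtMost d p = ∀ i → d < i → coeff p i ≡ 0ℤ

SelfReciprocal : ℕ → Poly → Set
SelfReciprocal d p = p ≈ reciprocal d p

selfReciprocal⇒degreeAtMost : ∀ {d p} → SelfReciprocal d p → DegreeAtMost d p
selfReciprocal⇒degreeAtMost {d} {p} p≈rp i d<i = trans (coeff-≡ p≈rp i) (coeff-reciprocal-> d p d<i)

reciprocal-cong : ∀ d {p q} → p ≈ q → reciprocal d p ≈ reciprocal d q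
reciprocal-cong zero    p≈q = ∷-cong (coeff-≡ p≈q 0) ≈-refl
reciprocal-cong (suc d) p≈q = ∷-cong (coeff-≡ p≈q (suc d)) (reciprocal-cong d p≈q)

selfReciprocal-cong : ∀ {d p q} → p ≈ q → SelfReciprocal d p → SelfReciprocal d q
selfReciprocal-cong {d} p≈q p≈rp = ≈-trans (≈-sym p≈q) (≈-trans p≈rp (reciprocal-cong d p≈q))

reciprocal-+P : ∀ d p q → reciprocal d (p +P q) ≈ reciprocal d p +P reciprocal d q
reciprocal-+P zero    p q = ∷-cong (coeff-+P p q 0) ≈-refl
reciprocal-+P (suc d) p q = ∷-cong (coeff-+P p q (suc d)) (reciprocal-+P d p q)

reciprocal-scale : ∀ d a q → reciprocal d (scale a q) ≈ scale a (reciprocal d q)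
reciprocal-scale zero    a q = ∷-cong (coeff-scale a q 0) ≈-refl
reciprocal-scale (suc d) a q = ∷-cong (coeff-scale a q (suc d)) (reciprocal-scale d a q)

reciprocal-[] : ∀ d → reciprocal d [] ≈ []
reciprocal-[] zero    = ∷-≈[] refl ≈-refl
reciprocal-[] (suc d) = ∷-≈[] refl (reciprocal-[] d)

reciprocal-0∷ : ∀ d p → reciprocal (suc d) (0ℤ ∷ p) ≈ reciprocal d p
reciprocal-0∷ zero    p = ∷-cong refl (∷-≈[] refl ≈-refl)
reciprocal-0∷ (suc d) p = ∷-cong refl (reciprocal-0∷ d p)

shift : ℕ → Poly → Poly
shift zero    p = p
shift (suc j) p = 0ℤ ∷ shift j p

shift-cong : ∀ j {p q} → p ≈ q → shift j p ≈ shift j q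
shift-cong zero    p≈q = p≈q
shift-cong (suc j) p≈q = ∷-cong refl (shift-cong j p≈q)

reciprocal-+ : ∀ j d p → DegreeAtMost d p → reciprocal (j + d) p ≈ shift j (reciprocal d p)
reciprocal-+ zero    d p _     = ≈-refl
reciprocal-+ (suc j) d p deg≤d = ∷-cong (deg≤d (suc (j + d)) (s≤s (m≤n+m d j))) (reciprocal-+ j d p deg≤d)

reciprocal-∷ : ∀ d a p → reciprocal (suc d) (a ∷ p) ≈ reciprocal d p +P shift (suc d) (a ∷ [])
reciprocal-∷ zero    a p = ∷-cong (sym (ℤP.+-identityʳ _)) ≈-refl
reciprocal-∷ (suc d) a p = ∷-cong (sym (ℤP.+-identityʳ _)) (reciprocal-∷ d a p)

shift-*P : ∀ j a q → shift j (a ∷ []) *P q ≈ shift j (scale a q)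
shift-*P zero    a q = ≈-trans (+P-cong (≈-refl {scale a q}) (∷-≈[] refl ≈-refl)) (+P-identityʳ (scale a q))
shift-*P (suc j) a q = ≈-trans (0∷-*P (shift j (a ∷ [])) q) (∷-cong refl (shift-*P j a q))

degreeAtMost-scale : ∀ d a q → DegreeAtMost d q → DegreeAtMost d (scale a q)
degreeAtMost-scale d a q deg≤d i d<i =
  trans (coeff-scale a q i) (trans (cong (a ℤ.*_) (deg≤d i d<i)) (ℤP.*-zeroʳ a))

reciprocal-*P : ∀ k n p q → DegreeAtMost k p → DegreeAtMost n q →
                reciprocal (k + n) (p *P q) ≈ reciprocal k p *P reciprocal n q
reciprocal-*P k n [] q _ _ =
  ≈-trans (reciprocal-[] (k + n)) (≈-sym (*P-zeroˡ (reciprocal n q) (reciprocal-[] k)))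
reciprocal-*P zero n (a ∷ p) q deg≤0 _ = begin
  reciprocal n ((a ∷ p) *P q)             ≈⟨ reciprocal-cong n aq≈ ⟩
  reciprocal n (scale a q)                ≈⟨ reciprocal-scale n a q ⟩
  scale a (reciprocal n q)                ≈⟨ shift-*P zero a (reciprocal n q) ⟨
  (a ∷ []) *P reciprocal n q              ∎
  where
  open ≈-Reasoning
  aq≈ : (a ∷ p) *P q ≈ scale a q
  aq≈ = ≈-trans (+P-cong (≈-refl {scale a q}) (∷-≈[] refl (*P-zeroˡ {p} q (mk≈ λ i → deg≤0 (suc i) (s≤s z≤n)))))
                (+P-identityʳ (scale a q))
reciprocal-*P (suc k) n (a ∷ p) q deg≤k deg≤n = begin
  reciprocal (suc k + n) (scale a q +P (0ℤ ∷ (p *P q)))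
    ≈⟨ reciprocal-+P (suc k + n) (scale a q) (0ℤ ∷ (p *P q)) ⟩
  reciprocal (suc k + n) (scale a q) +P reciprocal (suc k + n) (0ℤ ∷ (p *P q))
    ≈⟨ +P-cong (reciprocal-+ (suc k) n (scale a q) (degreeAtMost-scale n a q deg≤n))
               (≈-trans (reciprocal-0∷ (k + n) (p *P q))
                        (reciprocal-*P k n p q (λ i k<i → deg≤k (suc i) (s≤s k<i)) deg≤n)) ⟩
  shift (suc k) (reciprocal n (scale a q)) +P (reciprocal k p *P Q)
    ≈⟨ +P-comm (shift (suc k) (reciprocal n (scale a q))) (reciprocal k p *P Q) ⟩
  (reciprocal k p *P Q) +P shift (suc k) (reciprocal n (scale a q))
    ≈⟨ +P-cong (≈-refl {reciprocal k p *P Q})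
               (shift-cong (suc k) (reciprocal-scale n a q)) ⟩
  (reciprocal k p *P Q) +P shift (suc k) (scale a Q)
    ≈⟨ +P-cong (≈-refl {reciprocal k p *P Q}) (shift-*P (suc k) a Q) ⟨
  (reciprocal k p *P Q) +P (shift (suc k) (a ∷ []) *P Q)
    ≈⟨ *P-distribʳ (reciprocal k p) (shift (suc k) (a ∷ [])) Q ⟨
  (reciprocal k p +P shift (suc k) (a ∷ [])) *P Q
    ≈⟨ *P-congˡ Q (reciprocal-∷ k a p) ⟨
  reciprocal (suc k) (a ∷ p) *P Q
    ∎
  where
  open ≈-Reasoning
  Q : Poly
  Q = reciprocal n q

selfReciprocal-*P : ∀ {k n p q} → SelfReciprocal k p → SelfReciprocal n q → SelfReciprocal (k + n) (p *P q)
selfReciprocal-*P {k} {n} {p} {q} p≈rp q≈rq = begin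
  p *P q                                   ≈⟨ *P-congˡ q p≈rp ⟩
  reciprocal k p *P q                      ≈⟨ *P-congʳ (reciprocal k p) q≈rq ⟩
  reciprocal k p *P reciprocal n q         ≈⟨ reciprocal-*P k n p q (selfReciprocal⇒degreeAtMost p≈rp)
                                                                   (selfReciprocal⇒degreeAtMost q≈rq) ⟨
  reciprocal (k + n) (p *P q)              ∎
  where open ≈-Reasoning

-- Disjoint unions

↑ˡ-↑ʳ-elim : ∀ {k n} {P : Fin (k + n) → Set} → (∀ i → P (i ↑ˡ n)) → (∀ j → P (k ↑ʳ j)) → ∀ v → P v
↑ˡ-↑ʳ-elim {k} {n} {P} left right v with splitAt k v in eq
... | inj₁ i = subst P (splitAt⁻¹-↑ˡ eq) (left i)
... | inj₂ j = subst P (splitAt⁻¹-↑ʳ eq) (right j)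

≟-injective : ∀ {a b} (f : Fin a → Fin b) → (∀ {x y} → f x ≡ f y → x ≡ y) → ∀ i j → ⌊ f i ≟ f j ⌋ ≡ ⌊ i ≟ j ⌋
≟-injective f f-inj i j with i ≟ j | f i ≟ f j
... | yes _   | yes _     = refl
... | no _    | no _      = refl
... | yes i≡j | no fi≢fj  = ⊥-elim (fi≢fj (cong f i≡j))
... | no i≢j  | yes fi≡fj = ⊥-elim (i≢j (f-inj fi≡fj))

sum-map-zero : ∀ {A : Set} {f : A → ℕ} xs → (∀ x → f x ≡ 0) → sum (map f xs) ≡ 0
sum-map-zero []       f≡0 = refl
sum-map-zero (x ∷ xs) f≡0 = cong₂ _+_ (f≡0 x) (sum-map-zero xs f≡0)

graphOnSum : ∀ {k n} (R : Fin k ⊎ Fin n → Fin k ⊎ Fin n → Bool) →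
             (∀ s t → R s t ≡ R t s) → (∀ s → R s s ≡ false) → Graph (k + n)
graphOnSum {k} R R-sym R-irrefl = record
  { adj    = λ x y → R (splitAt k x) (splitAt k y)
  ; symm   = λ x y → R-sym (splitAt k x) (splitAt k y)
  ; irrefl = λ x → R-irrefl (splitAt k x)
  }

indicator : Bool → ℕ
indicator b = if b then 1 else 0

module _ {k n : ℕ} (G : Graph k) (H : Graph n) where

  unionAdj : Fin k ⊎ Fin n → Fin k ⊎ Fin n → Bool
  unionAdj (inj₁ a) (inj₁ b) = adj G a b
  unionAdj (inj₂ a) (inj₂ b) = adj H a b
  unionAdj (inj₁ _) (inj₂ _) = false
  unionAdj (inj₂ _) (inj₁ _) = false

  unionAdj-sym : ∀ s t → unionAdj s t ≡ unionAdj t s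
  unionAdj-sym (inj₁ a) (inj₁ b) = symm G a b
  unionAdj-sym (inj₂ a) (inj₂ b) = symm H a b
  unionAdj-sym (inj₁ _) (inj₂ _) = refl
  unionAdj-sym (inj₂ _) (inj₁ _) = refl

  unionAdj-irrefl : ∀ s → unionAdj s s ≡ false
  unionAdj-irrefl (inj₁ a) = irrefl G a
  unionAdj-irrefl (inj₂ a) = irrefl H a

  _⊕_ : Graph (k + n)
  _⊕_ = graphOnSum unionAdj unionAdj-sym unionAdj-irrefl

  adj-⊕-↑ˡ↑ˡ : ∀ i j → adj _⊕_ (i ↑ˡ n) (j ↑ˡ n) ≡ adj G i j
  adj-⊕-↑ˡ↑ˡ i j = cong₂ unionAdj (splitAt-↑ˡ k i n) (splitAt-↑ˡ k j n)

  adj-⊕-↑ʳ↑ʳ : ∀ i j → adj _⊕_ (k ↑ʳ i) (k ↑ʳ j) ≡ adj H i j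
  adj-⊕-↑ʳ↑ʳ i j = cong₂ unionAdj (splitAt-↑ʳ k n i) (splitAt-↑ʳ k n j)

  adj-⊕-↑ˡ↑ʳ : ∀ i j → adj _⊕_ (i ↑ˡ n) (k ↑ʳ j) ≡ false
  adj-⊕-↑ˡ↑ʳ i j = cong₂ unionAdj (splitAt-↑ˡ k i n) (splitAt-↑ʳ k n j)

  adj-⊕-↑ʳ↑ˡ : ∀ i j → adj _⊕_ (k ↑ʳ j) (i ↑ˡ n) ≡ false
  adj-⊕-↑ʳ↑ˡ i j = cong₂ unionAdj (splitAt-↑ʳ k n j) (splitAt-↑ˡ k i n)

  ≟-↑ˡ↑ʳ : ∀ i j → ⌊ i ↑ˡ n ≟ k ↑ʳ j ⌋ ≡ false
  ≟-↑ˡ↑ʳ i j with i ↑ˡ n ≟ k ↑ʳ j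
  ... | no _  = refl
  ... | yes e with trans (sym (splitAt-↑ˡ k i n)) (trans (cong (splitAt k) e) (splitAt-↑ʳ k n j))
  ...   | ()

  charPoly-⊕ : charPoly _⊕_ ≈ charPoly G *P charPoly H
  charPoly-⊕ = begin
    charPoly _⊕_
      ≈⟨ det-blockLowerTriangular k n (charMatrix _⊕_) upperZero ⟩
    det k (topLeft k n (charMatrix _⊕_)) *P det n (bottomRight k n (charMatrix _⊕_))
      ≈⟨ *P-congˡ _ (det-cong k λ i j → ≈-reflexive (cong₂ entry (≟-injective (_↑ˡ n) (↑ˡ-injective n _ _) i j)
                                                                 (adj-⊕-↑ˡ↑ˡ i j))) ⟩
    charPoly G *P det n (bottomRight k n (charMatrix _⊕_))
      ≈⟨ *P-congʳ (charPoly G) (det-cong n λ i j → ≈-reflexive (cong₂ entry (≟-injective (k ↑ʳ_) (↑ʳ-injective k _ _) i j)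
                                                                            (adj-⊕-↑ʳ↑ʳ i j))) ⟩
    charPoly G *P charPoly H
      ∎
    where
    open ≈-Reasoning
    entry : Bool → Bool → Poly
    entry diagonal adjacent = (if diagonal then 0ℤ ∷ 1ℤ ∷ [] else []) +P (- (if adjacent then 1ℤ else 0ℤ) ∷ [])
    upperZero : ∀ i j → charMatrix _⊕_ (i ↑ˡ n) (k ↑ʳ j) ≈ []
    upperZero i j = ≈-trans (≈-reflexive (cong₂ entry (≟-↑ˡ↑ʳ i j) (adj-⊕-↑ˡ↑ʳ i j))) (∷-≈[] refl ≈-refl)

  sum-allFin-+ : ∀ (f : Fin (k + n) → ℕ) →
                 sum (map f (allFin (k + n))) ≡ sum (map (f ∘ (_↑ˡ n)) (allFin k)) + sum (map (f ∘ (k ↑ʳ_)) (allFin n))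
  sum-allFin-+ f = trans (cong sum (map-allFin-+ k n f)) (sum-++ (map (f ∘ (_↑ˡ n)) (allFin k)) _)

  degree-⊕-↑ˡ : ∀ i → degree _⊕_ (i ↑ˡ n) ≡ degree G i
  degree-⊕-↑ˡ i = begin
    degree _⊕_ (i ↑ˡ n)
      ≡⟨ sum-allFin-+ (indicator ∘ adj _⊕_ (i ↑ˡ n)) ⟩
    sum (map (indicator ∘ adj _⊕_ (i ↑ˡ n) ∘ (_↑ˡ n)) (allFin k)) + sum (map (indicator ∘ adj _⊕_ (i ↑ˡ n) ∘ (k ↑ʳ_)) (allFin n))
      ≡⟨ cong₂ _+_ (cong sum (map-cong (cong indicator ∘ adj-⊕-↑ˡ↑ˡ i) (allFin k)))
                   (sum-map-zero (allFin n) (cong indicator ∘ adj-⊕-↑ˡ↑ʳ i)) ⟩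
    degree G i + 0
      ≡⟨ +-identityʳ (degree G i) ⟩
    degree G i
      ∎
    where open ≡-Reasoning

  degree-⊕-↑ʳ : ∀ j → degree _⊕_ (k ↑ʳ j) ≡ degree H j
  degree-⊕-↑ʳ j = begin
    degree _⊕_ (k ↑ʳ j)
      ≡⟨ sum-allFin-+ (indicator ∘ adj _⊕_ (k ↑ʳ j)) ⟩
    sum (map (indicator ∘ adj _⊕_ (k ↑ʳ j) ∘ (_↑ˡ n)) (allFin k)) + sum (map (indicator ∘ adj _⊕_ (k ↑ʳ j) ∘ (k ↑ʳ_)) (allFin n))
      ≡⟨ cong₂ _+_ (sum-map-zero (allFin k) λ i → cong indicator (adj-⊕-↑ʳ↑ˡ i j))
                   (cong sum (map-cong (cong indicator ∘ adj-⊕-↑ʳ↑ʳ j) (allFin n))) ⟩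
    degree H j
      ∎
    where open ≡-Reasoning

  bald-⊕ : Bald G → Bald H → Bald _⊕_
  bald-⊕ baldG baldH = ↑ˡ-↑ʳ-elim (λ i deg≡1 → baldG i (trans (sym (degree-⊕-↑ˡ i)) deg≡1))
                              (λ j deg≡1 → baldH j (trans (sym (degree-⊕-↑ʳ j)) deg≡1))

-- A bald palindromic graph on 8 vertices

module _ {k n : ℕ} (B : Fin k → Fin n → Bool) where

  bipartiteAdj : Fin k ⊎ Fin n → Fin k ⊎ Fin n → Bool
  bipartiteAdj (inj₁ a) (inj₂ b) = B a b
  bipartiteAdj (inj₂ b) (inj₁ a) = B a b
  bipartiteAdj (inj₁ _) (inj₁ _) = false
  bipartiteAdj (inj₂ _) (inj₂ _) = false

  bipartiteAdj-sym : ∀ s t → bipartiteAdj s t ≡ bipartiteAdj t s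
  bipartiteAdj-sym (inj₁ _) (inj₂ _) = refl
  bipartiteAdj-sym (inj₂ _) (inj₁ _) = refl
  bipartiteAdj-sym (inj₁ _) (inj₁ _) = refl
  bipartiteAdj-sym (inj₂ _) (inj₂ _) = refl

  bipartiteAdj-irrefl : ∀ s → bipartiteAdj s s ≡ false
  bipartiteAdj-irrefl (inj₁ _) = refl
  bipartiteAdj-irrefl (inj₂ _) = refl

  bipartite : Graph (k + n)
  bipartite = graphOnSum bipartiteAdj bipartiteAdj-sym bipartiteAdj-irrefl

biadjacency : Fin 4 → Fin 4 → Bool
biadjacency i j = lookup (lookup rows i) j
  where
  rows : Vec (Vec Bool 4) 4
  rows = (false ∷ true  ∷ false ∷ true  ∷ [])
       ∷ (true  ∷ true  ∷ true  ∷ false ∷ [])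
       ∷ (true  ∷ false ∷ true  ∷ false ∷ [])
       ∷ (true  ∷ true  ∷ false ∷ true  ∷ [])
       ∷ []

G₈ : Graph 8
G₈ = bipartite biadjacency

-- Stated for an arbitrary graph: checking det≈sparseDet at G₈ itself would make
-- the type checker evaluate the full Laplace expansion of det.
charPoly≈sparseDet : ∀ {n} (G : Graph n) → charPoly G ≈ sparseDet n (charMatrix G)
charPoly≈sparseDet {n} G = det≈sparseDet n (charMatrix G)

χ₈ : Poly
χ₈ = + 1 ∷ 0ℤ ∷ - + 10 ∷ 0ℤ ∷ + 23 ∷ 0ℤ ∷ - + 10 ∷ 0ℤ ∷ + 1 ∷ []

selfReciprocal-χ₈ : SelfReciprocal 8 χ₈
selfReciprocal-χ₈ = ≈-refl

charPoly-G₈ : charPoly G₈ ≈ χ₈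
charPoly-G₈ = ≈-trans (charPoly≈sparseDet G₈) (≈-reflexive refl)

bald-G₈ : Bald G₈
bald-G₈ = toWitness {a? = all? λ i → ¬? (degree G₈ i ℕ.≟ 1)} _

BaldSelfReciprocalGraph : ℕ → Set
BaldSelfReciprocalGraph n = Σ (Graph n) λ G → SelfReciprocal n (charPoly G) × Bald G

emptyGraph : BaldSelfReciprocalGraph 0
emptyGraph = record { adj = λ () ; symm = λ () ; irrefl = λ () } , ≈-refl , λ ()

_⊕-baldSelfReciprocal_ : ∀ {k n} → BaldSelfReciprocalGraph k → BaldSelfReciprocalGraph n → BaldSelfReciprocalGraph (k + n)
(G , selfRecipG , baldG) ⊕-baldSelfReciprocal (H , selfRecipH , baldH) =
  G ⊕ H , selfReciprocal-cong (≈-sym (charPoly-⊕ G H)) (selfReciprocal-*P selfRecipG selfRecipH) , bald-⊕ G H baldG baldH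

copies : ∀ {k} m → BaldSelfReciprocalGraph k → BaldSelfReciprocalGraph (m * k)
copies zero    _ = emptyGraph
copies (suc m) G = G ⊕-baldSelfReciprocal copies m G

G₈-baldSelfReciprocal : BaldSelfReciprocalGraph 8
G₈-baldSelfReciprocal = G₈ , selfReciprocal-cong {8} (≈-sym charPoly-G₈) selfReciprocal-χ₈ , bald-G₈

selfReciprocal⇒palindromic : ∀ {n} (G : Graph n) → SelfReciprocal n (charPoly G) → Palindromic G
selfReciprocal⇒palindromic {n} G χ≈rχ i =
  trans (coeff-≡ χ≈rχ (n ∸ toℕ i)) (coeff-reciprocal n (charPoly G) (m∸n≤m n (toℕ i)))

palindromicBald : ∀ {n} → BaldSelfReciprocalGraph n → Σ (Graph n) (λ G → Palindromic G × Bald G)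
palindromicBald (G , selfRecip , bald) = G , selfReciprocal⇒palindromic G selfRecip , bald

theorem3 : ∀ (m : ℕ) → 1 ≤ m → Σ (Graph (8 * m)) (λ G → Palindromic G × Bald G)
theorem3 m _ = palindromicBald (subst BaldSelfReciprocalGraph (*-comm m 8) (copies m G₈-baldSelfReciprocal))
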